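{- Let $A\subseteq\omega$ be intrinsically small. Then for every total computable injective function $f:\omega\to\omega$ whose range is computable, $\overline{\rho}(f(A))=0$.
   Context: For $A\subseteq\omega$ and $n\geq 1$, $\rho_n(A)=|A\cap\{0,\dots,n-1\}|/n$ and $\overline{\rho}(A)=\limsup_n\rho_n(A)$. A set $A$ is intrinsically small if it has intrinsic density $0$, i.e. $\overline{\rho}(\pi(A))=0$ for every computable permutation $\pi$ of $\omega$ (the paper uses this term for infinite sets). -}

module Defs where

open import Data.Nat using (ℕ; zero; suc; _+_; _*_; _≤_; _<_)
open import Data.Bool using (Bool; true; false; if_then_else_)
open import Data.Fin using (Fin)
open import Data.Vec using (Vec; []; _∷_; lookup)
open import Data.Product using (Σ; ∃; _×_; _,_)
open import Relation.Binary.PropositionalEquality using (_≡_)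
open import Function.Bundles using (_⇔_)
open import Function.Definitions using (Injective; Bijective)

data PR : ℕ → Set where
  zer  : ∀ {n} → PR n
  succ : PR 1
  proj : ∀ {n} → Fin n → PR n
  comp : ∀ {m n} → PR m → Vec (PR n) m → PR n
  prec : ∀ {n} → PR n → PR (suc (suc n)) → PR (suc n)
  mu   : ∀ {n} → PR (suc n) → PR n

mutual
  data _[_]⇓_ : ∀ {n} → PR n → Vec ℕ n → ℕ → Set where
    ev-zer  : ∀ {n} {xs : Vec ℕ n} → zer [ xs ]⇓ 0
    ev-succ : ∀ {x} → succ [ x ∷ [] ]⇓ suc x
    ev-proj : ∀ {n} {i : Fin n} {xs} → proj i [ xs ]⇓ lookup xs i
    ev-comp : ∀ {m n} {g : PR m} {hs : Vec (PR n) m} {xs ys y} →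
              hs [ xs ]⇓* ys → g [ ys ]⇓ y → comp g hs [ xs ]⇓ y
    ev-prec0 : ∀ {n} {g : PR n} {h} {xs y} →
               g [ xs ]⇓ y → prec g h [ 0 ∷ xs ]⇓ y
    ev-precS : ∀ {n} {g : PR n} {h} {k xs r y} →
               prec g h [ k ∷ xs ]⇓ r → h [ k ∷ r ∷ xs ]⇓ y →
               prec g h [ suc k ∷ xs ]⇓ y
    ev-mu   : ∀ {n} {f : PR (suc n)} {xs y} →
              f [ y ∷ xs ]⇓ 0 →
              (∀ z → z < y → ∃ λ v → f [ z ∷ xs ]⇓ suc v) →
              mu f [ xs ]⇓ y

  data _[_]⇓*_ : ∀ {m n} → Vec (PR n) m → Vec ℕ n → Vec ℕ m → Set where
    ev-[] : ∀ {n} {xs : Vec ℕ n} → [] [ xs ]⇓* []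
    ev-∷  : ∀ {m n} {h : PR n} {hs : Vec (PR n) m} {xs y ys} →
            h [ xs ]⇓ y → hs [ xs ]⇓* ys → (h ∷ hs) [ xs ]⇓* (y ∷ ys)

Computable : (ℕ → ℕ) → Set
Computable f = Σ (PR 1) λ e → ∀ n → e [ n ∷ [] ]⇓ f n

-- Subsets of ω are represented by characteristic functions ℕ → Bool.
ComputableSet : (ℕ → Bool) → Set
ComputableSet R = Computable (λ n → if R n then 1 else 0)

ComputableRange : (ℕ → ℕ) → Set
ComputableRange f =
  Σ (ℕ → Bool) λ R → ComputableSet R × (∀ n → (R n ≡ true) ⇔ (∃ λ m → f m ≡ n))

count : (ℕ → Bool) → ℕ → ℕ
count A zero    = 0
count A (suc n) = (if A n then 1 else 0) + count A n

-- limsup_n ρ_n(A) = 0, i.e. for every k ≥ 1, eventually ρ_n(A) ≤ 1/k,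
-- i.e. k * |A ∩ n| ≤ n.
UpperDensityZero : (ℕ → Bool) → Set
UpperDensityZero A = ∀ k → ∃ λ N → ∀ n → N ≤ n → k * count A n ≤ n

IsImage : (ℕ → ℕ) → (ℕ → Bool) → (ℕ → Bool) → Set
IsImage f A B = ∀ n → (B n ≡ true) ⇔ (∃ λ m → A m ≡ true × f m ≡ n)

Infinite : (ℕ → Bool) → Set
Infinite A = ∀ N → ∃ λ n → N ≤ n × A n ≡ true

IntrinsicallySmall : (ℕ → Bool) → Set
IntrinsicallySmall A =
  Infinite A ×
  (∀ (π : ℕ → ℕ) → Computable π → Bijective _≡_ _≡_ π →
     ∀ (B : ℕ → Bool) → IsImage π A B → UpperDensityZero B)

module Submission where

-- Split the domain of f into evens and odds. Because the range of f is computable, so is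
-- the set S = ℕ ∖ f(2ℕ) (decide y ∈ range f, find its preimage, test its parity); S is
-- infinite since it contains f(2ℕ + 1). Enumerating S in increasing order and interleaving
-- that enumeration with k ↦ f(2k) gives a computable permutation π₀ with π₀(2k) = f(2k), so
-- f(A ∩ 2ℕ) ⊆ π₀(A) has density 0. Running the same construction on f ∘ swap, where swap
-- exchanges 2k and 2k+1, gives π₁ with π₁(2k+1) = f(2k+1). Finally f(A) ⊆ π₀(A) ∪ π₁(A),
-- and a union of two sets of density 0 has density 0.

open import Data.Bool using (Bool; true; false; if_then_else_; not; _∧_; _∨_)
open import Data.Bool.Properties
  using (not-involutive; not-injective; ∧-conicalˡ; ∧-conicalʳ; ∨-conicalˡ; ∨-conicalʳ; T-≡)
open import Data.Fin using (Fin; toℕ; fromℕ<; #_)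
open import Data.Fin.Properties using (any?; pigeonhole; toℕ-fromℕ<)
open import Data.Nat
open import Data.Nat.Properties
open import Algebra.Properties.CommutativeSemigroup +-commutativeSemigroup using (interchange)
open import Data.Product using (Σ; ∃; _×_; _,_; proj₁; proj₂)
open import Data.Sum using (_⊎_; inj₁; inj₂; [_,_]′)
open import Data.Vec using (Vec; []; _∷_; lookup)
open import Defs
open import Function using (_∘_; case_of_)
open import Function.Bundles using (_⇔_; mk⇔; Equivalence)
import Function.Construct.Composition as Composition
open import Function.Definitions using (Injective; Surjective; Bijective)
open import Relation.Binary.Definitions using (tri<; tri≈; tri>)
open import Relation.Binary.PropositionalEquality
open import Relation.Nullary using (yes; no; contradiction)

-- Partial recursive functions

χ : Bool → ℕ
χ b = if b then 1 else 0

≡ᵇ-true⇒≡ : ∀ {m n} → (m ≡ᵇ n) ≡ true → m ≡ n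
≡ᵇ-true⇒≡ {m} {n} eq = ≡ᵇ⇒≡ m n (Equivalence.from T-≡ eq)

≡⇒≡ᵇ-true : ∀ {m n} → m ≡ n → (m ≡ᵇ n) ≡ true
≡⇒≡ᵇ-true {m} {n} eq = Equivalence.to T-≡ (≡⇒≡ᵇ m n eq)

Recursive : ∀ {n} → (Vec ℕ n → ℕ) → Set
Recursive {n} F = Σ (PR n) λ e → ∀ xs → e [ xs ]⇓ F xs

RecursiveVec : ∀ {m n} → (Vec ℕ n → Vec ℕ m) → Set
RecursiveVec {m} {n} F = Σ (Vec (PR n) m) λ es → ∀ xs → es [ xs ]⇓* F xs

RecursivePred : ∀ {n} → (Vec ℕ n → Bool) → Set
RecursivePred P = Recursive (λ xs → χ (P xs))

-- Records rather than abbreviations, so that f can be recovered by unification from the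
-- type of a proof.
record Recursive₁ (f : ℕ → ℕ) : Set where
  constructor unary
  field recursive : Recursive {1} (λ xs → f (lookup xs (# 0)))

record Recursive₂ (f : ℕ → ℕ → ℕ) : Set where
  constructor binary
  field recursive : Recursive {2} (λ xs → f (lookup xs (# 0)) (lookup xs (# 1)))

RecursivePred₁ : (ℕ → Bool) → Set
RecursivePred₁ P = Recursive₁ (λ x → χ (P x))

computable⇒recursive : ∀ {f} → Computable f → Recursive₁ f
computable⇒recursive (e , e⇓) = unary (e , λ { (x ∷ []) → e⇓ x })

recursive⇒computable : ∀ {f} → Recursive₁ f → Computable f
recursive⇒computable (unary (e , e⇓)) = e , λ x → e⇓ (x ∷ [])

recursive-cong : ∀ {n} {F G : Vec ℕ n → ℕ} → (∀ xs → F xs ≡ G xs) → Recursive F → Recursive G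
recursive-cong F≗G (e , e⇓) = e , λ xs → subst (e [ xs ]⇓_) (F≗G xs) (e⇓ xs)

succ-recursive : Recursive₁ suc
succ-recursive = unary (succ , λ { (x ∷ []) → ev-succ })

proj-recursive : ∀ {n} (i : Fin n) → Recursive (λ xs → lookup xs i)
proj-recursive i = proj i , λ _ → ev-proj

[]ʳ : ∀ {n} → RecursiveVec {0} {n} (λ _ → [])
[]ʳ = [] , λ _ → ev-[]

infixr 5 _∷ʳ_

_∷ʳ_ : ∀ {m n} {F : Vec ℕ n → ℕ} {G : Vec ℕ n → Vec ℕ m} →
       Recursive F → RecursiveVec G → RecursiveVec (λ xs → F xs ∷ G xs)
(e , e⇓) ∷ʳ (es , es⇓) = e ∷ es , λ xs → ev-∷ (e⇓ xs) (es⇓ xs)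

∘-recursive : ∀ {m n} {G : Vec ℕ m → ℕ} {H : Vec ℕ n → Vec ℕ m} →
              Recursive G → RecursiveVec H → Recursive (λ xs → G (H xs))
∘-recursive {H = H} (g , g⇓) (hs , hs⇓) = comp g hs , λ xs → ev-comp (hs⇓ xs) (g⇓ (H xs))

infixr 9 _∘ʳ_

_∘ʳ_ : ∀ {n} {g : ℕ → ℕ} {F : Vec ℕ n → ℕ} → Recursive₁ g → Recursive F → Recursive (λ xs → g (F xs))
unary g-rec ∘ʳ F-rec = ∘-recursive g-rec (F-rec ∷ʳ []ʳ)

∘₂-recursive : ∀ {n} {g : ℕ → ℕ → ℕ} {F G : Vec ℕ n → ℕ} →
               Recursive₂ g → Recursive F → Recursive G → Recursive (λ xs → g (F xs) (G xs))
∘₂-recursive (binary g-rec) F-rec G-rec = ∘-recursive g-rec (F-rec ∷ʳ G-rec ∷ʳ []ʳ)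

recursive₁-∘ : ∀ {g h} → Recursive₁ g → Recursive₁ h → Recursive₁ (g ∘ h)
recursive₁-∘ g-rec (unary h-rec) = unary (g-rec ∘ʳ h-rec)

const-recursive : ∀ {n} c → Recursive {n} (λ _ → c)
const-recursive zero    = zer , λ _ → ev-zer
const-recursive (suc c) = succ-recursive ∘ʳ const-recursive c

prec-recursive : ∀ {n} {F : Vec ℕ (suc n) → ℕ} {G H} → Recursive G → Recursive H →
                 (∀ xs → F (0 ∷ xs) ≡ G xs) →
                 (∀ k xs → F (suc k ∷ xs) ≡ H (k ∷ F (k ∷ xs) ∷ xs)) →
                 Recursive F
prec-recursive {F = F} (g , g⇓) (h , h⇓) base step = prec g h , eval
  where
  eval : ∀ xs → prec g h [ xs ]⇓ F xs
  eval (zero  ∷ xs) = subst (prec g h [ 0 ∷ xs ]⇓_) (sym (base xs)) (ev-prec0 (g⇓ xs))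
  eval (suc k ∷ xs) = subst (prec g h [ suc k ∷ xs ]⇓_) (sym (step k xs)) (ev-precS (eval (k ∷ xs)) (h⇓ _))

prec₁-recursive : ∀ {f : ℕ → ℕ} (h : ℕ → ℕ → ℕ) → Recursive₂ h →
                  (∀ k → f (suc k) ≡ h k (f k)) → Recursive₁ f
prec₁-recursive {f} _ (binary h-rec) step =
  unary (prec-recursive (const-recursive (f 0)) h-rec (λ { [] → refl }) (λ { k [] → step k }))

if-recursive : ∀ {n} {B : Vec ℕ n → Bool} {F G : Vec ℕ n → ℕ} →
               RecursivePred B → Recursive F → Recursive G →
               Recursive (λ xs → if B xs then F xs else G xs)
if-recursive {B = B} B-rec F-rec G-rec =
  recursive-cong (λ xs → select-χ (B xs)) (∘-recursive select (B-rec ∷ʳ F-rec ∷ʳ G-rec ∷ʳ []ʳ))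
  where
  select : Recursive {3} (λ xs → if lookup xs (# 0) ≡ᵇ 0 then lookup xs (# 2) else lookup xs (# 1))
  select = prec-recursive (proj-recursive (# 1)) (proj-recursive (# 2)) (λ _ → refl) (λ _ _ → refl)
  select-χ : ∀ b {x y} → (if χ b ≡ᵇ 0 then y else x) ≡ (if b then x else y)
  select-χ true  = refl
  select-χ false = refl

not-recursive : ∀ {n} {P : Vec ℕ n → Bool} → RecursivePred P → RecursivePred (λ xs → not (P xs))
not-recursive {P = P} P-rec =
  recursive-cong (λ xs → χ-not (P xs)) (if-recursive P-rec (const-recursive 0) (const-recursive 1))
  where
  χ-not : ∀ b → (if b then 0 else 1) ≡ χ (not b)
  χ-not true  = refl
  χ-not false = refl

∧-recursive : ∀ {n} {P Q : Vec ℕ n → Bool} → RecursivePred P → RecursivePred Q →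
              RecursivePred (λ xs → P xs ∧ Q xs)
∧-recursive {P = P} P-rec Q-rec =
  recursive-cong (λ xs → χ-∧ (P xs)) (if-recursive P-rec Q-rec (const-recursive 0))
  where
  χ-∧ : ∀ b {c} → (if b then χ c else 0) ≡ χ (b ∧ c)
  χ-∧ true  = refl
  χ-∧ false = refl

∨-recursive : ∀ {n} {P Q : Vec ℕ n → Bool} → RecursivePred P → RecursivePred Q →
              RecursivePred (λ xs → P xs ∨ Q xs)
∨-recursive {P = P} P-rec Q-rec =
  recursive-cong (λ xs → χ-∨ (P xs)) (if-recursive P-rec (const-recursive 1) Q-rec)
  where
  χ-∨ : ∀ b {c} → (if b then 1 else χ c) ≡ χ (b ∨ c)
  χ-∨ true  = refl
  χ-∨ false = refl

Least : (ℕ → Bool) → ℕ → Set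
Least P m = P m ≡ true × (∀ z → z < m → P z ≡ false)

least-below : ∀ P n → ∃ (Least P) ⊎ (∀ z → z < n → P z ≡ false)
least-below P zero = inj₂ λ _ ()
least-below P (suc n) with least-below P n
... | inj₁ found = inj₁ found
... | inj₂ none with P n in Pn
...   | true  = inj₁ (n , Pn , none)
...   | false = inj₂ λ z z<1+n → [ none z , (λ { refl → Pn }) ]′ (m<1+n⇒m<n∨m≡n z<1+n)

least : ∀ P {n} → P n ≡ true → ∃ (Least P)
least P {n} Pn with least-below P (suc n)
... | inj₁ found = found
... | inj₂ none with trans (sym Pn) (none n (n<1+n n))
...   | ()

μ : (P : ℕ → Bool) → ∃ (λ z → P z ≡ true) → ℕ
μ P (_ , Pz) = proj₁ (least P Pz)

μ-satisfies : ∀ P (w : ∃ λ z → P z ≡ true) → P (μ P w) ≡ true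
μ-satisfies P (_ , Pz) = proj₁ (proj₂ (least P Pz))

-- mu searches for the least zero of the code of χ ∘ not ∘ P, i.e. the least witness of P.
μ-recursive : ∀ {n} {P : Vec ℕ (suc n) → Bool} → RecursivePred P →
              (witness : ∀ xs → ∃ λ z → P (z ∷ xs) ≡ true) →
              Recursive (λ xs → μ (λ z → P (z ∷ xs)) (witness xs))
μ-recursive {P = P} P-rec witness = mu e , λ xs →
  let (_ , Pz) = witness xs
      (m , Pm , below) = least (λ z → P (z ∷ xs)) Pz
  in ev-mu (subst (e [ m ∷ xs ]⇓_) (cong (χ ∘ not) Pm) (e⇓ (m ∷ xs)))
           (λ z z<m → 0 , subst (e [ z ∷ xs ]⇓_) (cong (χ ∘ not) (below z z<m)) (e⇓ (z ∷ xs)))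
  where
  e = proj₁ (not-recursive P-rec)
  e⇓ = proj₂ (not-recursive P-rec)

+-recursive : Recursive₂ _+_
+-recursive = binary (prec-recursive (proj-recursive (# 0)) (succ-recursive ∘ʳ proj-recursive (# 1))
  (λ _ → refl) (λ _ _ → refl))

pred-recursive : Recursive₁ pred
pred-recursive = prec₁-recursive (λ k _ → k) (binary (proj-recursive (# 0))) (λ _ → refl)

∸-recursive : Recursive₂ _∸_
∸-recursive = binary (∘₂-recursive flipped (proj-recursive (# 1)) (proj-recursive (# 0)))
  where
  flipped : Recursive₂ (λ n m → m ∸ n)
  flipped = binary (prec-recursive (proj-recursive (# 0)) (pred-recursive ∘ʳ proj-recursive (# 1))
    (λ _ → refl) (λ k xs → sym (pred[m∸n]≡m∸[1+n] (lookup xs (# 0)) k)))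

≡ᵇ0-recursive : RecursivePred₁ (_≡ᵇ 0)
≡ᵇ0-recursive = prec₁-recursive (λ _ _ → 0) (binary (const-recursive 0)) (λ _ → refl)

≡ᵇ-recursive : Recursive₂ (λ m n → χ (m ≡ᵇ n))
≡ᵇ-recursive = binary (recursive-cong (λ xs → cong χ (sym (≡ᵇ-via-∸ (lookup xs (# 0)) (lookup xs (# 1)))))
  (∧-recursive (≡ᵇ0-recursive ∘ʳ ∘₂-recursive ∸-recursive x₀ x₁)
               (≡ᵇ0-recursive ∘ʳ ∘₂-recursive ∸-recursive x₁ x₀)))
  where
  x₀ = proj-recursive {2} (# 0)
  x₁ = proj-recursive {2} (# 1)
  ≡ᵇ-via-∸ : ∀ m n → (m ≡ᵇ n) ≡ ((m ∸ n ≡ᵇ 0) ∧ (n ∸ m ≡ᵇ 0))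
  ≡ᵇ-via-∸ zero    zero    = refl
  ≡ᵇ-via-∸ zero    (suc n) = refl
  ≡ᵇ-via-∸ (suc m) zero    = refl
  ≡ᵇ-via-∸ (suc m) (suc n) = ≡ᵇ-via-∸ m n

count-recursive : ∀ {S} → RecursivePred₁ S → Recursive₁ (count S)
count-recursive {S} S-rec =
  prec₁-recursive (λ k r → χ (S k) + r)
    (binary (∘₂-recursive +-recursive (S-rec ∘ʳ proj-recursive (# 0)) (proj-recursive (# 1))))
    (λ _ → refl)

oddᵇ : ℕ → Bool
oddᵇ zero    = false
oddᵇ (suc n) = not (oddᵇ n)

oddᵇ-recursive : RecursivePred₁ oddᵇ
oddᵇ-recursive = prec₁-recursive (λ _ r → χ (r ≡ᵇ 0)) (binary (≡ᵇ0-recursive ∘ʳ proj-recursive (# 1)))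
  (λ k → χ-not (oddᵇ k))
  where
  χ-not : ∀ b → χ (not b) ≡ χ (χ b ≡ᵇ 0)
  χ-not true  = refl
  χ-not false = refl

⌊1+n/2⌋≡⌊n/2⌋+χ[oddᵇn] : ∀ n → ⌊ suc n /2⌋ ≡ ⌊ n /2⌋ + χ (oddᵇ n)
⌊1+n/2⌋≡⌊n/2⌋+χ[oddᵇn] zero          = refl
⌊1+n/2⌋≡⌊n/2⌋+χ[oddᵇn] (suc zero)    = refl
⌊1+n/2⌋≡⌊n/2⌋+χ[oddᵇn] (suc (suc n)) rewrite not-involutive (oddᵇ n) =
  cong suc (⌊1+n/2⌋≡⌊n/2⌋+χ[oddᵇn] n)

⌊/2⌋-recursive : Recursive₁ ⌊_/2⌋
⌊/2⌋-recursive = prec₁-recursive (λ k r → r + χ (oddᵇ k))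
  (binary (∘₂-recursive +-recursive (proj-recursive (# 1)) (oddᵇ-recursive ∘ʳ proj-recursive (# 0))))
  ⌊1+n/2⌋≡⌊n/2⌋+χ[oddᵇn]

double-recursive : Recursive₁ (λ k → k + k)
double-recursive = unary (∘₂-recursive +-recursive (proj-recursive (# 0)) (proj-recursive (# 0)))

-- Parity and interleaving

data ParityView : ℕ → Set where
  even : ∀ k → ParityView (k + k)
  odd  : ∀ k → ParityView (suc (k + k))

parityView : ∀ n → ParityView n
parityView zero = even 0
parityView (suc n) with parityView n
... | even k = odd k
... | odd k  = subst ParityView (cong suc (+-suc k k)) (even (suc k))

oddᵇ-even : ∀ k → oddᵇ (k + k) ≡ false
oddᵇ-even zero    = refl
oddᵇ-even (suc k) rewrite +-suc k k | oddᵇ-even k = refl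

oddᵇ-odd : ∀ k → oddᵇ (suc (k + k)) ≡ true
oddᵇ-odd k = cong not (oddᵇ-even k)

double≢suc-double : ∀ i j → i + i ≢ suc (j + j)
double≢suc-double i j eq with trans (sym (oddᵇ-even i)) (trans (cong oddᵇ eq) (oddᵇ-odd j))
... | ()

double-injective : ∀ {i j} → i + i ≡ j + j → i ≡ j
double-injective {i} {j} eq = trans (n≡⌊n+n/2⌋ i) (trans (cong ⌊_/2⌋ eq) (sym (n≡⌊n+n/2⌋ j)))

interleave : (ℕ → ℕ) → (ℕ → ℕ) → ℕ → ℕ
interleave g h n = if oddᵇ n then h ⌊ n /2⌋ else g ⌊ n /2⌋

module _ {g h : ℕ → ℕ} where

  interleave-even : ∀ k → interleave g h (k + k) ≡ g k
  interleave-even k rewrite oddᵇ-even k = cong g (sym (n≡⌊n+n/2⌋ k))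

  interleave-odd : ∀ k → interleave g h (suc (k + k)) ≡ h k
  interleave-odd k rewrite oddᵇ-even k = cong h (sym (n≡⌈n+n/2⌉ k))

  interleave-recursive : Recursive₁ g → Recursive₁ h → Recursive₁ (interleave g h)
  interleave-recursive g-rec h-rec = unary (if-recursive (oddᵇ-recursive ∘ʳ x)
    (h-rec ∘ʳ ⌊/2⌋-recursive ∘ʳ x) (g-rec ∘ʳ ⌊/2⌋-recursive ∘ʳ x))
    where
    x = proj-recursive {1} (# 0)

  interleave-bijective : Injective _≡_ _≡_ g → Injective _≡_ _≡_ h →
                         (∀ i j → g i ≢ h j) →
                         (∀ y → (∃ λ i → g i ≡ y) ⊎ (∃ λ j → h j ≡ y)) →
                         Bijective _≡_ _≡_ (interleave g h)
  interleave-bijective g-inj h-inj disjoint cover = injective , surjective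
    where
    injective′ : ∀ {m n} → ParityView m → ParityView n → interleave g h m ≡ interleave g h n → m ≡ n
    injective′ (even i) (even j) eq =
      cong (λ k → k + k) (g-inj (trans (sym (interleave-even i)) (trans eq (interleave-even j))))
    injective′ (odd i)  (odd j)  eq =
      cong (λ k → suc (k + k)) (h-inj (trans (sym (interleave-odd i)) (trans eq (interleave-odd j))))
    injective′ (even i) (odd j)  eq =
      contradiction (trans (sym (interleave-even i)) (trans eq (interleave-odd j))) (disjoint i j)
    injective′ (odd i)  (even j) eq =
      contradiction (trans (sym (interleave-even j)) (trans (sym eq) (interleave-odd i))) (disjoint j i)

    injective : Injective _≡_ _≡_ (interleave g h)
    injective {m} {n} = injective′ (parityView m) (parityView n)

    surjective : Surjective _≡_ _≡_ (interleave g h)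
    surjective y with cover y
    ... | inj₁ (i , gi≡y) = i + i , λ { refl → trans (interleave-even i) gi≡y }
    ... | inj₂ (j , hj≡y) = suc (j + j) , λ { refl → trans (interleave-odd j) hj≡y }

swap : ℕ → ℕ
swap = interleave (λ k → suc (k + k)) (λ k → k + k)

swap-recursive : Recursive₁ swap
swap-recursive = interleave-recursive (recursive₁-∘ succ-recursive double-recursive) double-recursive

swap-bijective : Bijective _≡_ _≡_ swap
swap-bijective = interleave-bijective
  (λ eq → double-injective (suc-injective eq)) double-injective
  (λ i j eq → double≢suc-double j i (sym eq))
  (λ y → case parityView y of λ { (even k) → inj₂ (k , refl) ; (odd k) → inj₁ (k , refl) })

swap-even : ∀ k → swap (k + k) ≡ suc (k + k)
swap-even = interleave-even {g = λ k → suc (k + k)} {h = λ k → k + k}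

swap-odd : ∀ k → swap (suc (k + k)) ≡ k + k
swap-odd = interleave-odd {g = λ k → suc (k + k)} {h = λ k → k + k}

-- Counting and enumerating

module _ {S : ℕ → Bool} where

  count-mono : ∀ {m n} → m ≤ n → count S m ≤ count S n
  count-mono m≤n = go (≤⇒≤′ m≤n)
    where
    go : ∀ {m n} → m ≤′ n → count S m ≤ count S n
    go ≤′-refl        = ≤-refl
    go (≤′-step m≤′n) = ≤-trans (go m≤′n) (m≤n+m _ _)

  count-step : ∀ {y} → S y ≡ true → count S (suc y) ≡ suc (count S y)
  count-step Sy rewrite Sy = refl

  count-strict : ∀ {y y′} → y < y′ → S y ≡ true → count S y < count S y′
  count-strict y<y′ Sy = ≤-trans (≤-reflexive (sym (count-step Sy))) (count-mono y<y′)

  count-injective : ∀ {y y′} → S y ≡ true → S y′ ≡ true → count S y ≡ count S y′ → y ≡ y′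
  count-injective {y} {y′} Sy Sy′ eq with <-cmp y y′
  ... | tri< y<y′ _ _ = contradiction eq (<⇒≢ (count-strict y<y′ Sy))
  ... | tri≈ _ y≡y′ _ = y≡y′
  ... | tri> _ _ y′<y = contradiction (sym eq) (<⇒≢ (count-strict y′<y Sy′))

  count-grows : Infinite S → ∀ N → ∃ λ N′ → count S N < count S N′
  count-grows S-inf N =
    let (n , N≤n , Sn) = S-inf N
    in suc n , ≤-<-trans (count-mono N≤n) (≤-reflexive (sym (count-step Sn)))

  count-unbounded : Infinite S → ∀ k → ∃ λ N → k < count S N
  count-unbounded S-inf zero    = count-grows S-inf 0
  count-unbounded S-inf (suc k) =
    let (N , k<countN) = count-unbounded S-inf k
        (N′ , countN<countN′) = count-grows S-inf N
    in N′ , ≤-<-trans k<countN countN<countN′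

  count-hits : ∀ N {k} → k < count S N → ∃ λ y → S y ≡ true × count S y ≡ k
  count-hits zero    ()
  count-hits (suc N) {k} k<count with k <? count S N
  ... | yes k<count′ = count-hits N k<count′
  ... | no k≮count with S N in SN
  ...   | true  = N , SN , ≤-antisym (≮⇒≥ k≮count) (s≤s⁻¹ k<count)
  ...   | false = contradiction k<count k≮count

module Enumeration {S : ℕ → Bool} (S-recursive : RecursivePred₁ S) (S-infinite : Infinite S) where

  private
    IsEnumerated : ℕ → ℕ → Bool
    IsEnumerated k y = S y ∧ (count S y ≡ᵇ k)

    enumerated : ∀ k → ∃ λ y → IsEnumerated k y ≡ true
    enumerated k =
      let (N , k<countN) = count-unbounded S-infinite k
          (y , Sy , county≡k) = count-hits N k<countN
      in y , subst (λ b → b ∧ (count S y ≡ᵇ k) ≡ true) (sym Sy) (≡⇒≡ᵇ-true county≡k)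

  enumerate : ℕ → ℕ
  enumerate k = μ (IsEnumerated k) (enumerated k)

  enumerate-∈ : ∀ k → S (enumerate k) ≡ true
  enumerate-∈ k = ∧-conicalˡ _ _ (μ-satisfies (IsEnumerated k) (enumerated k))

  count-enumerate : ∀ k → count S (enumerate k) ≡ k
  count-enumerate k = ≡ᵇ-true⇒≡ (∧-conicalʳ _ _ (μ-satisfies (IsEnumerated k) (enumerated k)))

  enumerate-recursive : Recursive₁ enumerate
  enumerate-recursive = unary (μ-recursive
    (∧-recursive (S-recursive ∘ʳ proj-recursive (# 0))
                 (∘₂-recursive ≡ᵇ-recursive (count-recursive S-recursive ∘ʳ proj-recursive (# 0))
                                            (proj-recursive (# 1))))
    (λ xs → enumerated (lookup xs (# 0))))

  enumerate-injective : Injective _≡_ _≡_ enumerate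
  enumerate-injective {i} {j} eq = trans (sym (count-enumerate i)) (trans (cong (count S) eq) (count-enumerate j))

  enumerate-count : ∀ {y} → S y ≡ true → enumerate (count S y) ≡ y
  enumerate-count {y} Sy = count-injective (enumerate-∈ (count S y)) Sy (count-enumerate (count S y))

-- Extending f to a permutation

injective⇒unbounded : ∀ {g : ℕ → ℕ} → Injective _≡_ _≡_ g → ∀ N → ∃ λ j → N ≤ g j
injective⇒unbounded {g} g-inj N with any? (λ (i : Fin (suc N)) → N ≤? g (toℕ i))
... | yes (i , N≤gi) = toℕ i , N≤gi
... | no none with pigeonhole (n<1+n N) squeeze
  where
  squeeze : Fin (suc N) → Fin N
  squeeze i = fromℕ< (≰⇒> λ N≤gi → none (i , N≤gi))
... | i , j , i<j , squeeze-i≡squeeze-j =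
  contradiction (g-inj (trans (sym (toℕ-fromℕ< _)) (trans (cong toℕ squeeze-i≡squeeze-j) (toℕ-fromℕ< _))))
                (<⇒≢ i<j)

module EvenExtension {f : ℕ → ℕ} (f-recursive : Recursive₁ f) (f-injective : Injective _≡_ _≡_ f)
                     {R : ℕ → Bool} (R-recursive : RecursivePred₁ R)
                     (R-range : ∀ y → (R y ≡ true) ⇔ (∃ λ m → f m ≡ y)) where

  private
    f-in-range : ∀ m → R (f m) ≡ true
    f-in-range m = Equivalence.from (R-range (f m)) (m , refl)

    -- Outside the range every m qualifies, so there preimage y = 0.
    IsPreimage : ℕ → ℕ → Bool
    IsPreimage y m = not (R y) ∨ (f m ≡ᵇ y)

    preimage-exists : ∀ y → ∃ λ m → IsPreimage y m ≡ true
    preimage-exists y with R y in Ry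
    ... | true  = let (m , fm≡y) = Equivalence.to (R-range y) Ry in m , ≡⇒≡ᵇ-true fm≡y
    ... | false = 0 , refl

    preimage : ℕ → ℕ
    preimage y = μ (IsPreimage y) (preimage-exists y)

    f-preimage : ∀ {y} → R y ≡ true → f (preimage y) ≡ y
    f-preimage {y} Ry = ≡ᵇ-true⇒≡
      (subst (λ b → not b ∨ (f (preimage y) ≡ᵇ y) ≡ true) Ry (μ-satisfies (IsPreimage y) (preimage-exists y)))

    preimage-f : ∀ m → preimage (f m) ≡ m
    preimage-f m = f-injective (f-preimage (f-in-range m))

    preimage-recursive : Recursive₁ preimage
    preimage-recursive = unary (μ-recursive
      (∨-recursive (not-recursive (R-recursive ∘ʳ proj-recursive (# 1)))
                   (∘₂-recursive ≡ᵇ-recursive (f-recursive ∘ʳ proj-recursive (# 0)) (proj-recursive (# 1))))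
      (λ xs → preimage-exists (lookup xs (# 0))))

    NotEvenImage : ℕ → Bool
    NotEvenImage y = not (R y) ∨ oddᵇ (preimage y)

    NotEvenImage-f : ∀ m → NotEvenImage (f m) ≡ oddᵇ m
    NotEvenImage-f m =
      trans (cong (λ b → not b ∨ oddᵇ (preimage (f m))) (f-in-range m)) (cong oddᵇ (preimage-f m))

    f-even-∉ : ∀ k → NotEvenImage (f (k + k)) ≡ false
    f-even-∉ k = trans (NotEvenImage-f (k + k)) (oddᵇ-even k)

    f-odd-∈ : ∀ k → NotEvenImage (f (suc (k + k))) ≡ true
    f-odd-∈ k = trans (NotEvenImage-f (suc (k + k))) (oddᵇ-odd k)

    even-image : ∀ {y} → NotEvenImage y ≡ false → ∃ λ k → f (k + k) ≡ y
    even-image {y} ∉ = from-view (parityView (preimage y))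
      (f-preimage (not-injective (∨-conicalˡ _ _ ∉))) (∨-conicalʳ _ _ ∉)
      where
      from-view : ∀ {m} → ParityView m → f m ≡ y → oddᵇ m ≡ false → ∃ λ k → f (k + k) ≡ y
      from-view (even k) fm≡y _ = k , fm≡y
      from-view (odd k)  _    odd≡false with trans (sym (oddᵇ-odd k)) odd≡false
      ... | ()

    NotEvenImage-recursive : RecursivePred₁ NotEvenImage
    NotEvenImage-recursive =
      unary (∨-recursive (not-recursive (R-recursive ∘ʳ x)) (oddᵇ-recursive ∘ʳ preimage-recursive ∘ʳ x))
      where
      x = proj-recursive {1} (# 0)

    NotEvenImage-infinite : Infinite NotEvenImage
    NotEvenImage-infinite N =
      let (j , N≤) = injective⇒unbounded {λ j → f (suc (j + j))}
                       (λ eq → double-injective (suc-injective (f-injective eq))) N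
      in f (suc (j + j)) , N≤ , f-odd-∈ j

  open Enumeration NotEvenImage-recursive NotEvenImage-infinite

  extension : ℕ → ℕ
  extension = interleave (λ k → f (k + k)) enumerate

  extension-even : ∀ k → extension (k + k) ≡ f (k + k)
  extension-even = interleave-even {g = λ k → f (k + k)} {h = enumerate}

  extension-recursive : Recursive₁ extension
  extension-recursive = interleave-recursive {g = λ k → f (k + k)} {h = enumerate}
    (recursive₁-∘ f-recursive double-recursive) enumerate-recursive

  extension-bijective : Bijective _≡_ _≡_ extension
  extension-bijective = interleave-bijective {g = λ k → f (k + k)} {h = enumerate}
    (λ eq → double-injective (f-injective eq)) enumerate-injective disjoint cover
    where
    disjoint : ∀ i j → f (i + i) ≢ enumerate j
    disjoint i j eq = case trans (sym (f-even-∉ i)) (trans (cong NotEvenImage eq) (enumerate-∈ j)) of λ ()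

    cover : ∀ y → (∃ λ i → f (i + i) ≡ y) ⊎ (∃ λ j → enumerate j ≡ y)
    cover y = by-membership (NotEvenImage y) refl
      where
      by-membership : ∀ b → NotEvenImage y ≡ b → (∃ λ i → f (i + i) ≡ y) ⊎ (∃ λ j → enumerate j ≡ y)
      by-membership true  y∉ = inj₂ (count NotEvenImage y , enumerate-count y∉)
      by-membership false y∈ = inj₁ (even-image y∈)

computable-∘ : ∀ {g h} → Computable g → Computable h → Computable (g ∘ h)
computable-∘ g-comp h-comp =
  recursive⇒computable (recursive₁-∘ (computable⇒recursive g-comp) (computable⇒recursive h-comp))

extension-on-evens : ∀ {f} → Computable f → Injective _≡_ _≡_ f → ComputableRange f →
                     ∃ λ π → Computable π × Bijective _≡_ _≡_ π × (∀ k → π (k + k) ≡ f (k + k))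
extension-on-evens f-computable f-injective (R , R-computable , R-range) =
  extension , recursive⇒computable extension-recursive , extension-bijective , extension-even
  where
  open EvenExtension (computable⇒recursive f-computable) f-injective (computable⇒recursive R-computable) R-range

extension-on-odds : ∀ {f} → Computable f → Injective _≡_ _≡_ f → ComputableRange f →
                    ∃ λ π → Computable π × Bijective _≡_ _≡_ π × (∀ k → π (suc (k + k)) ≡ f (suc (k + k)))
extension-on-odds {f} f-computable f-injective (R , R-computable , R-range) =
  let (π , π-computable , π-bijective , π-even) = extension-on-evens
        (computable-∘ f-computable swap-computable)
        (Composition.injective _≡_ _≡_ _≡_ (proj₁ swap-bijective) f-injective)
        (R , R-computable , R-range∘swap)
  in π ∘ swap , computable-∘ π-computable swap-computable ,
     Composition.bijective _≡_ _≡_ _≡_ swap-bijective π-bijective ,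
     λ k → trans (cong π (swap-odd k)) (trans (π-even k) (cong f (swap-even k)))
  where
  swap-computable = recursive⇒computable swap-recursive
  R-range∘swap : ∀ y → (R y ≡ true) ⇔ (∃ λ m → f (swap m) ≡ y)
  R-range∘swap y = mk⇔
    (λ Ry → let (m , fm≡y) = Equivalence.to (R-range y) Ry
                (m′ , swap-m′≡m) = proj₂ swap-bijective m
            in m′ , trans (cong f (swap-m′≡m refl)) fm≡y)
    (λ (m , f-swap-m≡y) → Equivalence.from (R-range y) (swap m , f-swap-m≡y))

-- Images and density

image : ∀ {π : ℕ → ℕ} → Bijective _≡_ _≡_ π → (ℕ → Bool) → ℕ → Bool
image (_ , π-surjective) A y = A (proj₁ (π-surjective y))

image-isImage : ∀ {π} (π-bijective : Bijective _≡_ _≡_ π) A → IsImage π A (image π-bijective A)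
image-isImage (π-injective , π-surjective) A y = mk⇔
  (λ A[π⁻¹y] → π⁻¹y , A[π⁻¹y] , π[π⁻¹y]≡y refl)
  (λ (m , Am , πm≡y) → subst (λ x → A x ≡ true) (π-injective (trans πm≡y (sym (π[π⁻¹y]≡y refl)))) Am)
  where
  π⁻¹y = proj₁ (π-surjective y)
  π[π⁻¹y]≡y = proj₂ (π-surjective y)

count-cover : ∀ {B B₀ B₁} → (∀ y → B y ≡ true → B₀ y ≡ true ⊎ B₁ y ≡ true) →
              ∀ n → count B n ≤ count B₀ n + count B₁ n
count-cover cover zero = z≤n
count-cover {B} {B₀} {B₁} cover (suc n) = begin
  χ (B n) + count B n                                   ≤⟨ +-mono-≤ (χ-cover (cover n)) (count-cover cover n) ⟩
  (χ (B₀ n) + χ (B₁ n)) + (count B₀ n + count B₁ n)     ≡⟨ interchange (χ (B₀ n)) _ _ _ ⟩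
  (χ (B₀ n) + count B₀ n) + (χ (B₁ n) + count B₁ n)     ∎
  where
  open ≤-Reasoning
  χ-cover : ∀ {b b₀ b₁} → (b ≡ true → b₀ ≡ true ⊎ b₁ ≡ true) → χ b ≤ χ b₀ + χ b₁
  χ-cover {false}                  _ = z≤n
  χ-cover {true}  {true}           _ = s≤s z≤n
  χ-cover {true}  {false} {true}   _ = s≤s z≤n
  χ-cover {true}  {false} {false} b⇒ with b⇒ refl
  ... | inj₁ ()
  ... | inj₂ ()

+-≤-by-doubles : ∀ {a b n} → a + a ≤ n → b + b ≤ n → a + b ≤ n
+-≤-by-doubles {a} {b} a+a≤n b+b≤n with ≤-total a b
... | inj₁ a≤b = ≤-trans (+-monoˡ-≤ b a≤b) b+b≤n
... | inj₂ b≤a = ≤-trans (+-monoʳ-≤ a b≤a) a+a≤n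

UpperDensityZero-cover : ∀ {B B₀ B₁} → (∀ y → B y ≡ true → B₀ y ≡ true ⊎ B₁ y ≡ true) →
                         UpperDensityZero B₀ → UpperDensityZero B₁ → UpperDensityZero B
UpperDensityZero-cover {B} {B₀} {B₁} cover B₀-sparse B₁-sparse k =
  let (N₀ , bound₀) = B₀-sparse (k + k)
      (N₁ , bound₁) = B₁-sparse (k + k)
  in N₀ ⊔ N₁ , λ n N≤n →
    let bound₀′ = halve (bound₀ n (≤-trans (m≤m⊔n N₀ N₁) N≤n))
        bound₁′ = halve (bound₁ n (≤-trans (m≤n⊔m N₀ N₁) N≤n))
    in begin
      k * count B n                     ≤⟨ *-monoʳ-≤ k (count-cover cover n) ⟩
      k * (count B₀ n + count B₁ n)     ≡⟨ *-distribˡ-+ k (count B₀ n) (count B₁ n) ⟩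
      k * count B₀ n + k * count B₁ n   ≤⟨ +-≤-by-doubles {k * count B₀ n} bound₀′ bound₁′ ⟩
      n                                 ∎
  where
  open ≤-Reasoning
  halve : ∀ {c n} → (k + k) * c ≤ n → k * c + k * c ≤ n
  halve {c} {n} = subst (_≤ n) (*-distribʳ-+ c k k)

images-cover-image : ∀ {f π₀ π₁ A B}
                     (π₀-bijective : Bijective _≡_ _≡_ π₀) (π₁-bijective : Bijective _≡_ _≡_ π₁) →
                     (∀ k → π₀ (k + k) ≡ f (k + k)) → (∀ k → π₁ (suc (k + k)) ≡ f (suc (k + k))) →
                     IsImage f A B →
                     ∀ y → B y ≡ true → image π₀-bijective A y ≡ true ⊎ image π₁-bijective A y ≡ true
images-cover-image {A = A} π₀-bijective π₁-bijective π₀-even π₁-odd B-image y By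
  with Equivalence.to (B-image y) By
... | m , Am , fm≡y with parityView m
...   | even k =
  inj₁ (Equivalence.from (image-isImage π₀-bijective A y) (k + k , Am , trans (π₀-even k) fm≡y))
...   | odd k  =
  inj₂ (Equivalence.from (image-isImage π₁-bijective A y) (suc (k + k) , Am , trans (π₁-odd k) fm≡y))

theorem2p5 : (A : ℕ → Bool) → IntrinsicallySmall A →
    (f : ℕ → ℕ) → Computable f → Injective _≡_ _≡_ f → ComputableRange f →
    (B : ℕ → Bool) → IsImage f A B → UpperDensityZero B
theorem2p5 A (_ , small) f f-computable f-injective f-range B B-image =
  let (π₀ , π₀-computable , π₀-bijective , π₀-even) = extension-on-evens f-computable f-injective f-range
      (π₁ , π₁-computable , π₁-bijective , π₁-odd)  = extension-on-odds f-computable f-injective f-range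
  in UpperDensityZero-cover (images-cover-image π₀-bijective π₁-bijective π₀-even π₁-odd B-image)
       (small π₀ π₀-computable π₀-bijective _ (image-isImage π₀-bijective A))
       (small π₁ π₁-computable π₁-bijective _ (image-isImage π₁-bijective A))
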